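{- Let $n>1$ be an integer and let $d_1 > d_2$ be positive proper divisors of $n$. Write $d = d_1$ and let $Q$ be the set of prime divisors of $n$ that do not divide $d$. Then \[ \omega(X_n(d_1,d_2)) = \begin{cases} \min\left( \min_{p\in Q} p,\; f(n)\cdot f\left(\frac{n}{d}\right)\right), & \text{if } d_2 = 1,\\[2pt] \omega\left(X_{n/d_2}\left(1, \frac{d_1}{d_2}\right)\right), & \text{if } d_2 \mid d_1 \text{ and } d_2>1,\\[2pt] \max\left( f\left(\frac{n}{d_1}\right), f\left(\frac{n}{d_2}\right)\right), & \text{otherwise,}\end{cases} \] where, if $Q$ is empty, $\min_{p\in Q}p$ is interpreted as $+\infty$ (so the first case gives $f(n)\cdot f(n/d)$).
   Context: For an integer $n>1$ and a set $D$ of positive proper divisors of $n$, the gcd-graph $X_n(D)=X_n(d_1,\ldots,d_k)$ (where $D=\{d_1,\ldots,d_k\}$) has vertex set $\mathbb{Z}_n=\{0,1,\ldots,n-1\}$, and two distinct vertices $a,b$ are adjacent if and only if $\gcd(a-b,n)\in D$. For an integer $m>1$, $f(m)$ denotes the smallest prime divisor of $m$. $\omega$ denotes the clique number. -}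

module Defs where

open import Data.Nat using (ℕ; zero; suc; _<_; _≤_; _⊓_; _*_; ∣_-_∣)
open import Data.Nat.Divisibility using (_∣_; _∣?_)
open import Data.Nat.Primality using (Prime; prime?)
open import Data.Nat.GCD using (gcd)
open import Data.List using (List; length)
open import Data.List.Membership.Propositional using (_∈_)
open import Data.List.Relation.Unary.All using (All)
open import Data.List.Relation.Unary.AllPairs using (AllPairs)
open import Data.Maybe using (Maybe; just; nothing; maybe)
open import Data.Product using (_×_; Σ)
open import Relation.Nullary using (¬_; yes; no)
open import Relation.Binary.PropositionalEquality using (_≡_; _≢_)

-- The gcd-graph X_n(D) on vertex set Z_n = {0,…,n-1}, given by its adjacency
-- relation.  For a, b < n we have gcd(a - b, n) = gcd(|a - b|, n).
Adj : (n : ℕ) → (D : List ℕ) → ℕ → ℕ → Set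
Adj n D a b = a ≢ b × gcd ∣ a - b ∣ n ∈ D

-- A clique of X_n(D): a list of vertices of Z_n which are pairwise adjacent
-- (hence pairwise distinct).  Its size is its length.
IsClique : (n : ℕ) → (D : List ℕ) → List ℕ → Set
IsClique n D C = All (_< n) C × AllPairs (Adj n D) C

CliqueNumber : (n : ℕ) → (D : List ℕ) → ℕ → Set
CliqueNumber n D k =
  Σ (List ℕ) (λ C → IsClique n D C × length C ≡ k)
  × (∀ C → IsClique n D C → length C ≤ k)

searchPrimeDiv : ℕ → ℕ → ℕ → Maybe ℕ
searchPrimeDiv zero p m = nothing
searchPrimeDiv (suc fuel) p m with prime? p | p ∣? m
... | yes _ | yes _ = just p
... | _ | _ = searchPrimeDiv fuel (suc p) m

-- f(m): the smallest prime divisor of m (meaningful for m > 1; all prime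
-- divisors of m > 0 lie in [2, m], so the search over [2, m] is complete).
f : ℕ → ℕ
f m = maybe (λ q → q) m (searchPrimeDiv m 2 m)

searchQ : ℕ → ℕ → ℕ → ℕ → Maybe ℕ
searchQ zero p n d = nothing
searchQ (suc fuel) p n d with prime? p | p ∣? n | p ∣? d
... | yes _ | yes _ | no _ = just p
... | _ | _ | _ = searchQ fuel (suc p) n d

-- min Q where Q = {primes p ∣ n with p ∤ d}; nothing encodes Q = ∅ (min = +∞).
minQ : ℕ → ℕ → Maybe ℕ
minQ n d = searchQ n 2 n d

minWith : Maybe ℕ → ℕ → ℕ
minWith q c = maybe (λ p → p ⊓ c) c q

-- Write colour(a, b) = gcd(a - b, n), so that edges of X_n(D) are the pairs whose colour
-- lies in D.  Two vertices of colour d agree modulo d but not modulo r·d whenever r·d ∣ n,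
-- so a clique all of whose edges have colour d is separated by the digit ⌊a/d⌋ mod r;
-- with r = f(n/d) this bounds it by f(n/d), and the progression 0, d, 2d, … attains the
-- bound.  This gives the third case once one checks that a {d₁,d₂}-clique with d₂ ∤ d₁ is
-- monochromatic.  For D = {d, 1} the residue modulo a prime q ∈ Q separates all vertices,
-- and the pair (a mod f(n), ⌊a/d⌋ mod f(n/d)) does as well; a Chinese-remainder
-- construction attains the resulting minimum.  When d₂ ∣ d₁ every edge has colour
-- divisible by d₂, and a ↦ ⌊a/d₂⌋, a ↦ a·d₂ are graph homomorphisms in both directions
-- between X_n(d₁, d₂) and X_{n/d₂}(1, d₁/d₂).
module Submission where

open import Defs
open import Data.Nat
  using (ℕ; zero; suc; _+_; _*_; _∸_; _≤_; _<_; _⊔_; ∣_-_∣; NonZero; z≤n; s≤s; z<s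
        ; pred; _≟_; _≤?_; >-nonZero; ≢-nonZero⁻¹; s<s⁻¹; n>1⇒nonTrivial; nonTrivial⇒n>1)
open import Data.Nat.Properties
open import Data.Nat.DivMod
open import Data.Nat.Divisibility
open import Data.Nat.GCD
open import Data.Nat.Coprimality using (Coprime; gcd≡1⇒coprime; coprime-Bézout)
open import Data.Nat.Primality
open import Data.Nat.Primality.Factorisation using (factorisationHasAllPrimeFactors)
open import Data.Nat.ListAction using (product)
open import Data.Nat.ListAction.Properties using (∈⇒∣product; product≢0)
open import Data.Nat.Induction using (<-rec)
open import Data.Nat.Solver using (module +-*-Solver)
open import Data.Fin as Fin using (fromℕ<)
open import Data.Fin.Properties using (pigeonhole; fromℕ<-injective)
open import Data.List using (List; []; _∷_; length; map; lookup; filter; applyDownFrom; downFrom)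
open import Data.List.Properties using (length-map; length-applyDownFrom)
open import Data.List.Membership.Propositional using (_∈_; find)
open import Data.List.Membership.Propositional.Properties using (∈-lookup; ∈-filter⁺; ∈-filter⁻; ∈-downFrom⁺)
open import Data.List.Relation.Unary.Any using (here; there)
open import Data.List.Relation.Unary.All as All using (All; []; _∷_; all?)
open import Data.List.Relation.Unary.All.Properties as All using (¬All⇒Any¬)
open import Data.List.Relation.Unary.AllPairs as AllPairs using (AllPairs; []; _∷_)
open import Data.List.Relation.Unary.AllPairs.Properties as AllPairs using ()
open import Data.Maybe using (just; nothing)
open import Data.Product using (_×_; _,_; Σ; ∃-syntax; proj₁; proj₂)
open import Data.Sum using (_⊎_; inj₁; inj₂; [_,_]′)
open import Function using (id)
open import Relation.Binary using (Rel)
open import Relation.Nullary using (¬_; Dec; yes; no; contradiction)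
open import Relation.Nullary.Decidable using (_×-dec_; ¬?)
open import Relation.Binary.PropositionalEquality

-- Residues and differences

∣m+n*c-m+o*c∣≡∣n-o∣*c : ∀ m n o c → ∣ m + n * c - m + o * c ∣ ≡ ∣ n - o ∣ * c
∣m+n*c-m+o*c∣≡∣n-o∣*c m n o c = trans (∣m+n-m+o∣≡∣n-o∣ m (n * c) (o * c)) (sym (*-distribʳ-∣-∣ c n o))

%≡%⇒∣m-n∣≡∣m/c-n/c∣*c : ∀ c .{{_ : NonZero c}} m n → m % c ≡ n % c → ∣ m - n ∣ ≡ ∣ m / c - n / c ∣ * c
%≡%⇒∣m-n∣≡∣m/c-n/c∣*c c m n eq = begin
  ∣ m - n ∣                                 ≡⟨ cong₂ ∣_-_∣ (m≡m%n+[m/n]*n m c) (m≡m%n+[m/n]*n n c) ⟩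
  ∣ m % c + m / c * c - n % c + n / c * c ∣ ≡⟨ cong (λ t → ∣ m % c + m / c * c - t + n / c * c ∣) (sym eq) ⟩
  ∣ m % c + m / c * c - m % c + n / c * c ∣ ≡⟨ ∣m+n*c-m+o*c∣≡∣n-o∣*c (m % c) (m / c) (n / c) c ⟩
  ∣ m / c - n / c ∣ * c                     ∎
  where open ≡-Reasoning

%≡%⇒∣∣m-n∣ : ∀ c .{{_ : NonZero c}} m n → m % c ≡ n % c → c ∣ ∣ m - n ∣
%≡%⇒∣∣m-n∣ c m n eq = divides ∣ m / c - n / c ∣ (%≡%⇒∣m-n∣≡∣m/c-n/c∣*c c m n eq)

∣n∸m⇒%≡% : ∀ c .{{_ : NonZero c}} {m n} → m ≤ n → c ∣ n ∸ m → n % c ≡ m % c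
∣n∸m⇒%≡% c {m} m≤n c∣n∸m = trans (cong (_% c) (sym (m+[n∸m]≡n m≤n))) (%-remove-+ʳ m c∣n∸m)

∣∣m-n∣⇒%≡% : ∀ c .{{_ : NonZero c}} m n → c ∣ ∣ m - n ∣ → m % c ≡ n % c
∣∣m-n∣⇒%≡% c m n c∣ with ≤-total m n
... | inj₁ m≤n = sym (∣n∸m⇒%≡% c m≤n (subst (c ∣_) (m≤n⇒∣m-n∣≡n∸m m≤n) c∣))
... | inj₂ n≤m = ∣n∸m⇒%≡% c n≤m (subst (c ∣_) (m≤n⇒∣n-m∣≡n∸m n≤m) c∣)

%-cong-*ˡ : ∀ c .{{_ : NonZero c}} a {b b'} → b % c ≡ b' % c → (a * b) % c ≡ (a * b') % c
%-cong-*ˡ c a {b} {b'} eq =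
  trans (%-distribˡ-* a b c) (trans (cong (λ t → (a % c * t) % c) eq) (sym (%-distribˡ-* a b' c)))

%∧/-injective : ∀ c .{{_ : NonZero c}} {m n} → m % c ≡ n % c → m / c ≡ n / c → m ≡ n
%∧/-injective c {m} {n} same-rem same-quot = begin
  m                 ≡⟨ m≡m%n+[m/n]*n m c ⟩
  m % c + m / c * c ≡⟨ cong₂ (λ a b → a + b * c) same-rem same-quot ⟩
  n % c + n / c * c ≡⟨ sym (m≡m%n+[m/n]*n n c) ⟩
  n                 ∎
  where open ≡-Reasoning

digits-injective : ∀ p .{{_ : NonZero p}} {a a' b b'} → a < p → a' < p →
                   a + b * p ≡ a' + b' * p → a ≡ a' × b ≡ b'
digits-injective p {a} {a'} {b} {b'} a<p a'<p eq = a≡a' , *-cancelʳ-≡ b b' p (+-cancelˡ-≡ a _ _ eq')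
  where
  a≡a' : a ≡ a'
  a≡a' = begin
    a                ≡⟨ sym (m<n⇒m%n≡m a<p) ⟩
    a % p            ≡⟨ sym ([m+kn]%n≡m%n a b p) ⟩
    (a + b * p) % p   ≡⟨ cong (_% p) eq ⟩
    (a' + b' * p) % p ≡⟨ [m+kn]%n≡m%n a' b' p ⟩
    a' % p           ≡⟨ m<n⇒m%n≡m a'<p ⟩
    a'               ∎
    where open ≡-Reasoning
  eq' : a + b * p ≡ a + b' * p
  eq' = trans eq (cong (_+ b' * p) (sym a≡a'))

digits< : ∀ {p r a b} → a < p → b < r → a + b * p < p * r
digits< {p} {r} {a} {b} a<p b<r = begin-strict
  a + b * p <⟨ +-monoˡ-< (b * p) a<p ⟩
  suc b * p ≤⟨ *-monoˡ-≤ p b<r ⟩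
  r * p     ≡⟨ *-comm r p ⟩
  p * r     ∎
  where open ≤-Reasoning

-- Primes, gcds and the smallest prime factor

prime⇒1< : ∀ {p} → Prime p → 1 < p
prime⇒1< {p} (prime _) = nonTrivial⇒n>1 p

primeDivisor : ∀ {t} → 1 < t → ∃[ ℓ ] Prime ℓ × ℓ ∣ t
primeDivisor {t} = <-rec (λ t → 1 < t → ∃[ ℓ ] Prime ℓ × ℓ ∣ t) go t
  where
  go : ∀ t → (∀ {s} → s < t → 1 < s → ∃[ ℓ ] Prime ℓ × ℓ ∣ s) → 1 < t → ∃[ ℓ ] Prime ℓ × ℓ ∣ t
  go t rec 1<t with prime? t
  ... | yes pt = t , pt , ∣-refl
  ... | no ¬pt with hasNonTrivialDivisor {s} s<t s∣t ← ¬prime⇒composite {{n>1⇒nonTrivial 1<t}} ¬pt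
      with ℓ , pℓ , ℓ∣s ← rec s<t (nonTrivial⇒n>1 s) = ℓ , pℓ , ∣-trans ℓ∣s s∣t

gcd≡d-byPrimes : ∀ a d e .{{_ : NonZero d}} .{{_ : NonZero e}} → d ∣ a →
                 (∀ {ℓ} → Prime ℓ → ℓ ∣ e → ¬ d * ℓ ∣ a) → gcd a (d * e) ≡ d
gcd≡d-byPrimes a d e d∣a no-lift with divides t g≡t*d ← gcd-greatest d∣a (m∣m*n {d} e) = go t g≡t*d
  where
  go : ∀ t → gcd a (d * e) ≡ t * d → gcd a (d * e) ≡ d
  go 0 g≡0 = contradiction (gcd[m,n]≡0⇒n≡0 a g≡0) (≢-nonZero⁻¹ (d * e) {{m*n≢0 d e}})
  go 1 g≡d = trans g≡d (*-identityˡ d)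
  go t@(suc (suc _)) g≡t*d with ℓ , pℓ , ℓ∣t ← primeDivisor {t} (s≤s (s≤s z≤n)) =
    contradiction (∣-trans (*-monoʳ-∣ d ℓ∣t) (subst (_∣ a) g≡d*t (gcd[m,n]∣m a (d * e))))
                  (no-lift pℓ (∣-trans ℓ∣t t∣e))
    where
    g≡d*t : gcd a (d * e) ≡ d * t
    g≡d*t = trans g≡t*d (*-comm t d)
    t∣e : t ∣ e
    t∣e = *-cancelˡ-∣ d (subst (_∣ d * e) g≡d*t (gcd[m,n]∣n a (d * e)))

gcd≡1-byPrimes : ∀ a e .{{_ : NonZero e}} → (∀ {ℓ} → Prime ℓ → ℓ ∣ e → ¬ ℓ ∣ a) → gcd a e ≡ 1
gcd≡1-byPrimes a e no-prime = subst (λ t → gcd a t ≡ 1) (*-identityˡ e)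
  (gcd≡d-byPrimes a 1 e (1∣ a) (λ pℓ ℓ∣e 1*ℓ∣a → no-prime pℓ ℓ∣e (subst (_∣ a) (*-identityˡ _) 1*ℓ∣a)))

gcd[m*c,n*c]≡gcd[m,n]*c : ∀ m n c → gcd (m * c) (n * c) ≡ gcd m n * c
gcd[m*c,n*c]≡gcd[m,n]*c m n c = begin
  gcd (m * c) (n * c) ≡⟨ cong₂ gcd (*-comm m c) (*-comm n c) ⟩
  gcd (c * m) (c * n) ≡⟨ sym (c*gcd[m,n]≡gcd[cm,cn] c m n) ⟩
  c * gcd m n         ≡⟨ *-comm c (gcd m n) ⟩
  gcd m n * c         ∎
  where open ≡-Reasoning

1<n/d : ∀ {n d} .{{_ : NonZero d}} → d ∣ n → d < n → 1 < n / d
1<n/d d∣n d<n = subst (1 <_) (sym (n/m≡quotient d∣n)) (quotient>1 d∣n d<n)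

¬2+m≤divisor : ∀ {ℓ m} → 0 < m → ℓ ∣ m → ¬ 2 + m ≤ ℓ
¬2+m≤divisor 0<m ℓ∣m = <⇒≱ (s≤s (m≤n⇒m≤1+n (∣⇒≤ {{>-nonZero 0<m}} ℓ∣m)))

private
  skip : ∀ {p ℓ} → p ≤ ℓ → ℓ ≢ p → suc p ≤ ℓ
  skip p≤ℓ ℓ≢p = ≤∧≢⇒< p≤ℓ (≢-sym ℓ≢p)

module _ (m : ℕ) where

  searchPrimeDiv-just : ∀ fuel p {q} → searchPrimeDiv fuel p m ≡ just q →
                        (Prime q × q ∣ m) × (∀ {ℓ} → Prime ℓ → ℓ ∣ m → p ≤ ℓ → q ≤ ℓ)
  searchPrimeDiv-just zero p ()
  searchPrimeDiv-just (suc fuel) p eq with prime? p | p ∣? m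
  searchPrimeDiv-just (suc fuel) p refl | yes pp | yes p∣m = (pp , p∣m) , λ _ _ p≤ℓ → p≤ℓ
  ... | yes _ | no p∤m with found , least ← searchPrimeDiv-just fuel (suc p) eq =
    found , λ pℓ ℓ∣m p≤ℓ → least pℓ ℓ∣m (skip p≤ℓ λ { refl → p∤m ℓ∣m })
  ... | no ¬pp | _ with found , least ← searchPrimeDiv-just fuel (suc p) eq =
    found , λ pℓ ℓ∣m p≤ℓ → least pℓ ℓ∣m (skip p≤ℓ λ { refl → ¬pp pℓ })

  searchPrimeDiv-nothing : ∀ fuel p → searchPrimeDiv fuel p m ≡ nothing →
                           ∀ {ℓ} → Prime ℓ → ℓ ∣ m → p ≤ ℓ → p + fuel ≤ ℓ
  searchPrimeDiv-nothing zero p _ _ _ p≤ℓ = subst (_≤ _) (sym (+-identityʳ p)) p≤ℓ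
  searchPrimeDiv-nothing (suc fuel) p eq {ℓ} pℓ ℓ∣m p≤ℓ with prime? p | p ∣? m
  searchPrimeDiv-nothing (suc fuel) p () pℓ ℓ∣m p≤ℓ | yes _ | yes _
  ... | yes _ | no p∤m = subst (_≤ ℓ) (sym (+-suc p fuel))
    (searchPrimeDiv-nothing fuel (suc p) eq pℓ ℓ∣m (skip p≤ℓ λ { refl → p∤m ℓ∣m }))
  ... | no ¬pp | _ = subst (_≤ ℓ) (sym (+-suc p fuel))
    (searchPrimeDiv-nothing fuel (suc p) eq pℓ ℓ∣m (skip p≤ℓ λ { refl → ¬pp pℓ }))

f-correct : ∀ {m} → 1 < m → (Prime (f m) × f m ∣ m) × (∀ {ℓ} → Prime ℓ → ℓ ∣ m → f m ≤ ℓ)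
f-correct {m} 1<m with searchPrimeDiv m 2 m in eq
... | just q with found , least ← searchPrimeDiv-just m m 2 eq = found , λ pℓ ℓ∣m → least pℓ ℓ∣m (prime⇒1< pℓ)
... | nothing with ℓ , pℓ , ℓ∣m ← primeDivisor 1<m =
  contradiction (searchPrimeDiv-nothing m m 2 eq pℓ ℓ∣m (prime⇒1< pℓ)) (¬2+m≤divisor (<-trans z<s 1<m) ℓ∣m)

f-prime : ∀ {m} → 1 < m → Prime (f m)
f-prime 1<m = proj₁ (proj₁ (f-correct 1<m))

f-∣ : ∀ {m} → 1 < m → f m ∣ m
f-∣ 1<m = proj₂ (proj₁ (f-correct 1<m))

f-minimal : ∀ {m ℓ} → 1 < m → Prime ℓ → ℓ ∣ m → f m ≤ ℓ
f-minimal 1<m = proj₂ (f-correct 1<m)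

<f⇒coprime : ∀ {e t} → 1 < e → 0 < t → t < f e → gcd t e ≡ 1
<f⇒coprime {e} {t} 1<e 0<t t<f = gcd≡1-byPrimes t e {{>-nonZero (<-trans z<s 1<e)}}
  λ pℓ ℓ∣e ℓ∣t → <⇒≱ (<-≤-trans t<f (f-minimal 1<e pℓ ℓ∣e)) (∣⇒≤ {{>-nonZero 0<t}} ℓ∣t)

-- The primes of n not dividing d

QPrime : ℕ → ℕ → ℕ → Set
QPrime n d ℓ = Prime ℓ × ℓ ∣ n × ¬ ℓ ∣ d

QPrime? : ∀ n d ℓ → Dec (QPrime n d ℓ)
QPrime? n d ℓ = prime? ℓ ×-dec (ℓ ∣? n ×-dec ¬? (ℓ ∣? d))

module _ (n d : ℕ) where

  searchQ-just : ∀ fuel p {q} → searchQ fuel p n d ≡ just q →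
                 QPrime n d q × (∀ {ℓ} → QPrime n d ℓ → p ≤ ℓ → q ≤ ℓ)
  searchQ-just zero p ()
  searchQ-just (suc fuel) p eq with prime? p | p ∣? n | p ∣? d
  searchQ-just (suc fuel) p refl | yes pp | yes p∣n | no p∤d = (pp , p∣n , p∤d) , λ _ p≤ℓ → p≤ℓ
  ... | yes _ | yes p∣n | yes p∣d with found , least ← searchQ-just fuel (suc p) eq =
    found , λ qℓ p≤ℓ → least qℓ (skip p≤ℓ λ { refl → proj₂ (proj₂ qℓ) p∣d })
  ... | yes _ | no p∤n | _ with found , least ← searchQ-just fuel (suc p) eq =
    found , λ qℓ p≤ℓ → least qℓ (skip p≤ℓ λ { refl → p∤n (proj₁ (proj₂ qℓ)) })
  ... | no ¬pp | _ | _ with found , least ← searchQ-just fuel (suc p) eq =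
    found , λ qℓ p≤ℓ → least qℓ (skip p≤ℓ λ { refl → ¬pp (proj₁ qℓ) })

  searchQ-nothing : ∀ fuel p → searchQ fuel p n d ≡ nothing →
                    ∀ {ℓ} → QPrime n d ℓ → p ≤ ℓ → p + fuel ≤ ℓ
  searchQ-nothing zero p _ _ p≤ℓ = subst (_≤ _) (sym (+-identityʳ p)) p≤ℓ
  searchQ-nothing (suc fuel) p eq {ℓ} qℓ p≤ℓ with prime? p | p ∣? n | p ∣? d
  searchQ-nothing (suc fuel) p () qℓ p≤ℓ | yes _ | yes _ | no _
  ... | yes _ | yes _ | yes p∣d = subst (_≤ ℓ) (sym (+-suc p fuel))
    (searchQ-nothing fuel (suc p) eq qℓ (skip p≤ℓ λ { refl → proj₂ (proj₂ qℓ) p∣d }))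
  ... | yes _ | no p∤n | _ = subst (_≤ ℓ) (sym (+-suc p fuel))
    (searchQ-nothing fuel (suc p) eq qℓ (skip p≤ℓ λ { refl → p∤n (proj₁ (proj₂ qℓ)) }))
  ... | no ¬pp | _ | _ = subst (_≤ ℓ) (sym (+-suc p fuel))
    (searchQ-nothing fuel (suc p) eq qℓ (skip p≤ℓ λ { refl → ¬pp (proj₁ qℓ) }))

minWith-minQ-lowerBound : ∀ {n} d c → 0 < n →
  minWith (minQ n d) c ≤ c × (∀ {ℓ} → QPrime n d ℓ → minWith (minQ n d) c ≤ ℓ)
minWith-minQ-lowerBound {n} d c 0<n with minQ n d in eq
... | just q = m⊓n≤n q c , λ qℓ → ≤-trans (m⊓n≤m q c) (proj₂ (searchQ-just n d n 2 eq) qℓ (prime⇒1< (proj₁ qℓ)))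
... | nothing = ≤-refl , λ qℓ → contradiction (searchQ-nothing n d n 2 eq qℓ (prime⇒1< (proj₁ qℓ)))
                                               (¬2+m≤divisor 0<n (proj₁ (proj₂ qℓ)))

minWith-minQ-greatest : ∀ {n d c L} → L ≤ c → (∀ {ℓ} → QPrime n d ℓ → L ≤ ℓ) → L ≤ minWith (minQ n d) c
minWith-minQ-greatest {n} {d} {c} L≤c L≤Q with minQ n d in eq
... | just q = ⊓-glb (L≤Q (proj₁ (searchQ-just n d n 2 eq))) L≤c
... | nothing = L≤c

∃multiple≡1-mod : ∀ T M .{{_ : NonZero T}} → Coprime T M → ∃[ F ] M ∣ F × F % T ≡ 1 % T
∃multiple≡1-mod T M coprime with coprime-Bézout coprime
... | Bézout.-+ x y 1+x*T≡y*M = y * M , n∣m*n y , trans (cong (_% T) (sym 1+x*T≡y*M)) ([m+kn]%n≡m%n 1 x T)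
... | Bézout.+- x y 1+y*M≡x*T = u * pred T , ∣m⇒∣m*n (pred T) (n∣m*n y) , (begin
  u * pred T % T              ≡⟨ sym ([m+kn]%n≡m%n (u * pred T) x T) ⟩
  (u * pred T + x * T) % T    ≡⟨ cong (λ t → (u * pred T + t) % T) (sym 1+y*M≡x*T) ⟩
  (u * pred T + (1 + u)) % T  ≡⟨ cong (_% T) (rearrange u (pred T)) ⟩
  (1 + u * suc (pred T)) % T  ≡⟨ cong (λ t → (1 + u * t) % T) (suc-pred T) ⟩
  (1 + u * T) % T             ≡⟨ [m+kn]%n≡m%n 1 u T ⟩
  1 % T                       ∎)
  where
  open ≡-Reasoning
  u : ℕ
  u = y * M
  rearrange : ∀ u t → u * t + (1 + u) ≡ 1 + u * suc t
  rearrange = +-*-Solver.solve 2 (λ u t → u :* t :+ (con 1 :+ u) := con 1 :+ u :* (con 1 :+ t)) refl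
    where open +-*-Solver

module _ (n d : ℕ) .{{_ : NonZero n}} .{{_ : NonZero d}} where

  private
    Qprimes : List ℕ
    Qprimes = filter (QPrime? n d) (downFrom (suc n))

    Qprimes-QPrime : ∀ {ℓ} → ℓ ∈ Qprimes → QPrime n d ℓ
    Qprimes-QPrime ℓ∈ = proj₂ (∈-filter⁻ (QPrime? n d) {xs = downFrom (suc n)} ℓ∈)

    QPrime⇒∈Qprimes : ∀ {ℓ} → QPrime n d ℓ → ℓ ∈ Qprimes
    QPrime⇒∈Qprimes qℓ = ∈-filter⁺ (QPrime? n d) (∈-downFrom⁺ (s≤s (∣⇒≤ (proj₁ (proj₂ qℓ))))) qℓ

    Qprimes-prime : All Prime Qprimes
    Qprimes-prime = All.tabulate (λ ℓ∈ → proj₁ (Qprimes-QPrime ℓ∈))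

    T : ℕ
    T = product Qprimes

    instance
      T≢0 : NonZero T
      T≢0 = product≢0 (All.map prime⇒nonZero Qprimes-prime)

    T-coprime : Coprime T (d * d)
    T-coprime = gcd≡1⇒coprime (gcd≡1-byPrimes T (d * d) {{m*n≢0 d d}} λ pℓ ℓ∣d*d ℓ∣T →
      proj₂ (proj₂ (Qprimes-QPrime (factorisationHasAllPrimeFactors pℓ ℓ∣T Qprimes-prime)))
            ([ id , id ]′ (euclidsLemma d d pℓ ℓ∣d*d)))

  ∃[d*d]-multiple≡1-modQ : ∃[ F ] d * d ∣ F × (∀ {ℓ} .{{_ : NonZero ℓ}} → QPrime n d ℓ → F % ℓ ≡ 1 % ℓ)
  ∃[d*d]-multiple≡1-modQ with F , d*d∣F , F≡1 ← ∃multiple≡1-mod T (d * d) T-coprime = F , d*d∣F , F≡1-modQ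
    where
    F≡1-modQ : ∀ {ℓ} .{{_ : NonZero ℓ}} → QPrime n d ℓ → F % ℓ ≡ 1 % ℓ
    F≡1-modQ {ℓ} qℓ = begin
      F % ℓ     ≡⟨ sym (m∣n⇒o%n%m≡o%m ℓ T F ℓ∣T) ⟩
      F % T % ℓ ≡⟨ cong (_% ℓ) F≡1 ⟩
      1 % T % ℓ ≡⟨ m∣n⇒o%n%m≡o%m ℓ T 1 ℓ∣T ⟩
      1 % ℓ     ∎
      where
      open ≡-Reasoning
      ℓ∣T : ℓ ∣ T
      ℓ∣T = ∈⇒∣product (QPrime⇒∈Qprimes qℓ)

-- Colours, cliques and homomorphisms of gcd-graphs

colour : ℕ → ℕ → ℕ → ℕ
colour n a b = gcd ∣ a - b ∣ n

colour-sym : ∀ n a b → colour n a b ≡ colour n b a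
colour-sym n a b = cong (λ t → gcd t n) (∣-∣-comm a b)

colour-refl : ∀ n a → colour n a a ≡ n
colour-refl n a = trans (cong (λ t → gcd t n) (∣n-n∣≡0 a)) (gcd-identityˡ n)

colour<n⇒≢ : ∀ {n a b t} → colour n a b ≡ t → t < n → a ≢ b
colour<n⇒≢ {n} {a} col≡t t<n refl = <⇒≢ t<n (trans (sym col≡t) (colour-refl n a))

colour≡d⇒%≡% : ∀ {n a b d} .{{_ : NonZero d}} → colour n a b ≡ d → a % d ≡ b % d
colour≡d⇒%≡% {n} {a} {b} {d} col≡d = ∣∣m-n∣⇒%≡% d a b (subst (_∣ ∣ a - b ∣) col≡d (gcd[m,n]∣m ∣ a - b ∣ n))

∈-pair : ∀ {g a b : ℕ} → g ∈ a ∷ b ∷ [] → g ≡ a ⊎ g ≡ b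
∈-pair (here g≡a) = inj₁ g≡a
∈-pair (there (here g≡b)) = inj₂ g≡b

HasCliqueOfSize : ℕ → List ℕ → ℕ → Set
HasCliqueOfSize n D k = Σ (List ℕ) (λ C → IsClique n D C × length C ≡ k)

Monochromatic : ℕ → List ℕ → List ℕ → ℕ → Set
Monochromatic n D C d = ∀ {z w} → z ∈ C → w ∈ C → Adj n D z w → colour n z w ≡ d

module _ {a r} {A : Set a} {R : Rel A r} where

  AllPairs-lookup : ∀ {xs} → AllPairs R xs → ∀ {i j} → i Fin.< j → R (lookup xs i) (lookup xs j)
  AllPairs-lookup (Rx ∷ _)   {Fin.zero}  {Fin.suc j} _   = All.lookup Rx (∈-lookup j)
  AllPairs-lookup (_ ∷ Rxs)  {Fin.suc i} {Fin.suc j} i<j = AllPairs-lookup Rxs (s<s⁻¹ i<j)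

  AllPairs-∈ : ∀ {xs x y} → AllPairs R xs → x ∈ xs → y ∈ xs → x ≡ y ⊎ R x y ⊎ R y x
  AllPairs-∈ (_ ∷ _)    (here refl) (here refl) = inj₁ refl
  AllPairs-∈ (Rx ∷ _)   (here refl) (there y∈)  = inj₂ (inj₁ (All.lookup Rx y∈))
  AllPairs-∈ (Rx ∷ _)   (there x∈)  (here refl) = inj₂ (inj₂ (All.lookup Rx x∈))
  AllPairs-∈ (_ ∷ Rxs)  (there x∈)  (there y∈)  = AllPairs-∈ Rxs x∈ y∈

  colouring⇒length≤ : ∀ {xs} B (h : A → ℕ) → AllPairs R xs → (∀ x → h x < B) →
                      (∀ {x y} → x ∈ xs → y ∈ xs → R x y → h x ≢ h y) → length xs ≤ B
  colouring⇒length≤ {xs} B h Rxs h<B separates with length xs ≤? B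
  ... | yes |xs|≤B = |xs|≤B
  ... | no |xs|≰B with i , j , i<j , same ← pigeonhole (≰⇒> |xs|≰B) (λ i → fromℕ< (h<B (lookup xs i))) =
    contradiction (fromℕ<-injective _ _ (h<B _) (h<B _) same)
                  (separates (∈-lookup i) (∈-lookup j) (AllPairs-lookup Rxs i<j))

clique-colour : ∀ {n D C z w} → IsClique n D C → z ∈ C → w ∈ C → z ≢ w → colour n z w ∈ D
clique-colour {n} {D} {z = z} {w} (_ , pairs) z∈ w∈ z≢w with AllPairs-∈ pairs z∈ w∈
... | inj₁ z≡w = contradiction z≡w z≢w
... | inj₂ (inj₁ (_ , zw∈D)) = zw∈D
... | inj₂ (inj₂ (_ , wz∈D)) = subst (_∈ D) (colour-sym n w z) wz∈D

downFrom-clique : ∀ {n D} (g : ℕ → ℕ) m → (∀ {k} → k < m → g k < n) →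
                  (∀ {k k'} → k' < k → k < m → Adj n D (g k) (g k')) → HasCliqueOfSize n D m
downFrom-clique g m g<n g-adj =
  applyDownFrom g m , (All.applyDownFrom⁺₁ g m g<n , AllPairs.applyDownFrom⁺₁ g m g-adj) , length-applyDownFrom g m

record Hom (n : ℕ) (D : List ℕ) (n' : ℕ) (D' : List ℕ) : Set where
  field
    vertex   : ℕ → ℕ
    vertex<  : ∀ {z} → z < n → vertex z < n'
    adjacent : ∀ {z w} → Adj n D z w → Adj n' D' (vertex z) (vertex w)

hom-clique : ∀ {n D n' D' C} (h : Hom n D n' D') → IsClique n D C → IsClique n' D' (map (Hom.vertex h) C)
hom-clique h (C<n , pairs) = All.map⁺ (All.map vertex< C<n) , AllPairs.map⁺ (AllPairs.map adjacent pairs)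
  where open Hom h

cliqueNumber-transfer : ∀ {n D n' D' k} → Hom n D n' D' → Hom n' D' n D → CliqueNumber n D k → CliqueNumber n' D' k
cliqueNumber-transfer {k = k} h h' ((C , clique , |C|≡k) , bounded) =
  (map (Hom.vertex h) C , hom-clique h clique , trans (length-map _ C) |C|≡k) ,
  λ C' clique' → subst (_≤ k) (length-map _ C') (bounded _ (hom-clique h' clique'))

-- Upper bounds

colour≡d⇒digit≢ : ∀ {n d r z w} .{{_ : NonZero d}} .{{_ : NonZero r}} → 1 < r → r * d ∣ n →
                  colour n z w ≡ d → (z / d) % r ≢ (w / d) % r
colour≡d⇒digit≢ {n} {d} {r} {z} {w} 1<r r*d∣n col≡d same-digit = >⇒≢ 1<r (∣1⇒≡1 r∣1)
  where
  r*d∣diff : r * d ∣ ∣ z - w ∣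
  r*d∣diff = subst (r * d ∣_) (sym (%≡%⇒∣m-n∣≡∣m/c-n/c∣*c d z w (colour≡d⇒%≡% col≡d)))
                   (*-monoˡ-∣ d (%≡%⇒∣∣m-n∣ r (z / d) (w / d) same-digit))
  r∣1 : r ∣ 1
  r∣1 = *-cancelʳ-∣ d (subst (r * d ∣_) (trans col≡d (sym (*-identityˡ d))) (gcd-greatest r*d∣diff r*d∣n))

monochromatic⇒length≤ : ∀ {n D C d r} .{{_ : NonZero d}} → 1 < r → r * d ∣ n →
                        IsClique n D C → Monochromatic n D C d → length C ≤ r
monochromatic⇒length≤ {d = d} {r} 1<r r*d∣n (_ , pairs) mono =
  colouring⇒length≤ r (λ x → (x / d) % r) pairs (λ x → m%n<n (x / d) r)
    λ z∈ w∈ zw → colour≡d⇒digit≢ 1<r r*d∣n (mono z∈ w∈ zw)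
  where
  instance
    r≢0 : NonZero r
    r≢0 = >-nonZero (<-trans z<s 1<r)

∤colours⇒length≤ : ∀ {n D C ℓ} .{{_ : NonZero ℓ}} → ℓ ∣ n → (∀ {g} → g ∈ D → ¬ ℓ ∣ g) →
                   IsClique n D C → length C ≤ ℓ
∤colours⇒length≤ {ℓ = ℓ} ℓ∣n ℓ∤D (_ , pairs) =
  colouring⇒length≤ ℓ (_% ℓ) pairs (λ x → m%n<n x ℓ)
    λ {z} {w} _ _ (_ , col∈D) same → ℓ∤D col∈D (gcd-greatest (%≡%⇒∣∣m-n∣ ℓ z w same) ℓ∣n)

QPrime⇒∤[d,1] : ∀ {n d ℓ} → QPrime n d ℓ → ∀ {g} → g ∈ d ∷ 1 ∷ [] → ¬ ℓ ∣ g
QPrime⇒∤[d,1] (pℓ , _ , ℓ∤d) g∈ ℓ∣g with ∈-pair g∈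
... | inj₁ refl = ℓ∤d ℓ∣g
... | inj₂ refl = >⇒≢ (prime⇒1< pℓ) (∣1⇒≡1 ℓ∣g)

clique[d,1]≤p*r : ∀ {n d p r C} .{{_ : NonZero d}} → Prime p → p ∣ n → 1 < r → r * d ∣ n →
                  IsClique n (d ∷ 1 ∷ []) C → length C ≤ p * r
clique[d,1]≤p*r {n} {d} {p} {r} {C} pp p∣n 1<r r*d∣n (_ , pairs) =
  colouring⇒length≤ (p * r) h pairs (λ x → digits< (m%n<n x p) (m%n<n (x / d) r)) separates
  where
  instance
    p≢0 : NonZero p
    p≢0 = prime⇒nonZero pp
    r≢0 : NonZero r
    r≢0 = >-nonZero (<-trans z<s 1<r)
  h : ℕ → ℕ
  h x = x % p + (x / d) % r * p
  separates : ∀ {z w} → z ∈ C → w ∈ C → Adj n (d ∷ 1 ∷ []) z w → h z ≢ h w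
  separates {z} {w} _ _ (_ , col∈) same with digits-injective p (m%n<n z p) (m%n<n w p) same | ∈-pair col∈
  ... | _ , same-digit | inj₁ col≡d = colour≡d⇒digit≢ 1<r r*d∣n col≡d same-digit
  ... | same-mod-p , _ | inj₂ col≡1 =
    >⇒≢ (prime⇒1< pp) (∣1⇒≡1 (subst (p ∣_) col≡1 (gcd-greatest (%≡%⇒∣∣m-n∣ p z w same-mod-p) p∣n)))

module _ {n d₁ d₂ : ℕ} .{{_ : NonZero d₁}} .{{_ : NonZero d₂}} (d₂∣n : d₂ ∣ n) (d₂∤d₁ : ¬ d₂ ∣ d₁) where

  colour≡d₁⇒≡-mod-d₁ : ∀ {C z w u} → IsClique n (d₁ ∷ d₂ ∷ []) C → z ∈ C → w ∈ C → u ∈ C →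
                       colour n z w ≡ d₁ → u % d₁ ≡ z % d₁
  colour≡d₁⇒≡-mod-d₁ {C} {z} {w} {u} clique z∈ w∈ u∈ zw≡d₁ with u ≟ z | u ≟ w
  ... | yes refl | _ = refl
  ... | no _ | yes refl = sym (colour≡d⇒%≡% zw≡d₁)
  ... | no u≢z | no u≢w with ∈-pair (clique-colour clique u∈ z∈ u≢z) | ∈-pair (clique-colour clique u∈ w∈ u≢w)
  ...   | inj₁ uz≡d₁ | _ = colour≡d⇒%≡% uz≡d₁
  ...   | inj₂ _ | inj₁ uw≡d₁ = trans (colour≡d⇒%≡% uw≡d₁) (sym (colour≡d⇒%≡% zw≡d₁))
  ...   | inj₂ uz≡d₂ | inj₂ uw≡d₂ = contradiction (subst (d₂ ∣_) zw≡d₁ (gcd-greatest d₂∣z-w d₂∣n)) d₂∤d₁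
    where
    d₂∣z-w : d₂ ∣ ∣ z - w ∣
    d₂∣z-w = %≡%⇒∣∣m-n∣ d₂ z w (trans (sym (colour≡d⇒%≡% {n} {u} uz≡d₂)) (colour≡d⇒%≡% {n} {u} uw≡d₂))

  clique-monochromatic : d₁ ∣ n → d₂ < d₁ → ∀ C → IsClique n (d₁ ∷ d₂ ∷ []) C →
                         Monochromatic n (d₁ ∷ d₂ ∷ []) C d₁ ⊎ Monochromatic n (d₁ ∷ d₂ ∷ []) C d₂
  clique-monochromatic _ _ [] _ = inj₁ λ ()
  clique-monochromatic d₁∣n d₂<d₁ C@(x₀ ∷ _) clique with all? (λ y → y % d₁ ≟ x₀ % d₁) C
  ... | yes all≡x₀ = inj₁ only-d₁
    where
    only-d₁ : Monochromatic n (d₁ ∷ d₂ ∷ []) C d₁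
    only-d₁ {z} {w} z∈ w∈ (_ , col∈) with ∈-pair col∈
    ... | inj₁ col≡d₁ = col≡d₁
    ... | inj₂ col≡d₂ = contradiction (∣⇒≤ (subst (d₁ ∣_) col≡d₂ (gcd-greatest d₁∣z-w d₁∣n))) (<⇒≱ d₂<d₁)
      where
      d₁∣z-w : d₁ ∣ ∣ z - w ∣
      d₁∣z-w = %≡%⇒∣∣m-n∣ d₁ z w (trans (All.lookup all≡x₀ z∈) (sym (All.lookup all≡x₀ w∈)))
  ... | no ¬all≡x₀ with y , y∈ , y≢x₀ ← find (¬All⇒Any¬ (λ y → y % d₁ ≟ x₀ % d₁) C ¬all≡x₀) = inj₂ only-d₂
    where
    only-d₂ : Monochromatic n (d₁ ∷ d₂ ∷ []) C d₂
    only-d₂ {z} z∈ w∈ (_ , col∈) with ∈-pair col∈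
    ... | inj₂ col≡d₂ = col≡d₂
    ... | inj₁ col≡d₁ = contradiction (trans (≡z y∈) (sym (≡z (here refl)))) y≢x₀
      where
      ≡z : ∀ {u} → u ∈ C → u % d₁ ≡ z % d₁
      ≡z u∈ = colour≡d₁⇒≡-mod-d₁ clique z∈ w∈ u∈ col≡d₁

-- Lower bounds and rescaling

progression-clique : ∀ {n d e D} .{{_ : NonZero d}} → e * d ≡ n → 1 < e → d ∈ D → HasCliqueOfSize n D (f e)
progression-clique {n} {d} {e} {D} e*d≡n 1<e d∈D = downFrom-clique (_* d) (f e) k*d<n adjacent
  where
  instance
    e≢0 : NonZero e
    e≢0 = >-nonZero (<-trans z<s 1<e)
  k*d<n : ∀ {k} → k < f e → k * d < n
  k*d<n k<f = subst (_ <_) e*d≡n (*-monoˡ-< d (<-≤-trans k<f (∣⇒≤ (f-∣ 1<e))))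
  colour≡d : ∀ {k k'} → k' < k → k < f e → colour n (k * d) (k' * d) ≡ d
  colour≡d {k} {k'} k'<k k<f = begin
    gcd ∣ k * d - k' * d ∣ n     ≡⟨ cong₂ gcd (sym (*-distribʳ-∣-∣ d k k')) (sym e*d≡n) ⟩
    gcd (∣ k - k' ∣ * d) (e * d) ≡⟨ gcd[m*c,n*c]≡gcd[m,n]*c ∣ k - k' ∣ e d ⟩
    gcd ∣ k - k' ∣ e * d         ≡⟨ cong (_* d) (<f⇒coprime 1<e 0<gap gap<f) ⟩
    1 * d                        ≡⟨ *-identityˡ d ⟩
    d                            ∎
    where
    open ≡-Reasoning
    gap≡ : ∣ k - k' ∣ ≡ k ∸ k'
    gap≡ = m≤n⇒∣n-m∣≡n∸m (<⇒≤ k'<k)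
    0<gap : 0 < ∣ k - k' ∣
    0<gap = subst (0 <_) (sym gap≡) (m<n⇒0<n∸m k'<k)
    gap<f : ∣ k - k' ∣ < f e
    gap<f = ≤-<-trans (subst (_≤ k) (sym gap≡) (m∸n≤m k k')) k<f
  adjacent : ∀ {k k'} → k' < k → k < f e → Adj n D (k * d) (k' * d)
  adjacent {k} {k'} k'<k k<f =
    (λ same → <⇒≢ k'<k (sym (*-cancelʳ-≡ k k' d same))) , subst (_∈ D) (sym (colour≡d k'<k k<f)) d∈D

module _ {n d₁ e : ℕ} .{{_ : NonZero e}} (e∣n : e ∣ n) (e∣d₁ : e ∣ d₁) where

  private
    D D' : List ℕ
    D = d₁ ∷ e ∷ []
    D' = 1 ∷ d₁ / e ∷ []

    colour-multiply : ∀ z w → colour n (z * e) (w * e) ≡ colour (n / e) z w * e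
    colour-multiply z w = trans (cong₂ gcd (sym (*-distribʳ-∣-∣ e z w)) (sym (m/n*n≡m e∣n)))
                                (gcd[m*c,n*c]≡gcd[m,n]*c ∣ z - w ∣ (n / e) e)

    colour-divide : ∀ z w → z % e ≡ w % e → colour n z w ≡ colour (n / e) (z / e) (w / e) * e
    colour-divide z w same = trans (cong₂ gcd (%≡%⇒∣m-n∣≡∣m/c-n/c∣*c e z w same) (sym (m/n*n≡m e∣n)))
                                   (gcd[m*c,n*c]≡gcd[m,n]*c ∣ z / e - w / e ∣ (n / e) e)

    ∈D'⇒*e∈D : ∀ {c} → c ∈ D' → c * e ∈ D
    ∈D'⇒*e∈D c∈ with ∈-pair c∈
    ... | inj₁ refl = there (here (*-identityˡ e))
    ... | inj₂ refl = here (m/n*n≡m e∣d₁)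

    *e∈D⇒∈D' : ∀ {c} → c * e ∈ D → c ∈ D'
    *e∈D⇒∈D' {c} c*e∈ with ∈-pair c*e∈
    ... | inj₁ c*e≡d₁ = there (here (*-cancelʳ-≡ c _ e (trans c*e≡d₁ (sym (m/n*n≡m e∣d₁)))))
    ... | inj₂ c*e≡e = here (*-cancelʳ-≡ c 1 e (trans c*e≡e (sym (*-identityˡ e))))

  divide-hom : Hom n D (n / e) D'
  divide-hom = record { vertex = _/ e ; vertex< = vertex< ; adjacent = adjacent }
    where
    vertex< : ∀ {z} → z < n → z / e < n / e
    vertex< z<n = m<n*o⇒m/o<n (subst (_ <_) (sym (m/n*n≡m e∣n)) z<n)
    adjacent : ∀ {z w} → Adj n D z w → Adj (n / e) D' (z / e) (w / e)
    adjacent {z} {w} (z≢w , col∈D) = (λ same-quotient → z≢w (%∧/-injective e same-rem same-quotient)) ,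
                                     *e∈D⇒∈D' (subst (_∈ D) (colour-divide z w same-rem) col∈D)
      where
      e∣colour : e ∣ colour n z w
      e∣colour with ∈-pair col∈D
      ... | inj₁ col≡d₁ = subst (e ∣_) (sym col≡d₁) e∣d₁
      ... | inj₂ col≡e = subst (e ∣_) (sym col≡e) ∣-refl
      same-rem : z % e ≡ w % e
      same-rem = ∣∣m-n∣⇒%≡% e z w (∣-trans e∣colour (gcd[m,n]∣m ∣ z - w ∣ n))

  multiply-hom : Hom (n / e) D' n D
  multiply-hom = record { vertex = _* e ; vertex< = vertex< ; adjacent = adjacent }
    where
    vertex< : ∀ {z} → z < n / e → z * e < n
    vertex< z<n/e = subst (_ <_) (m/n*n≡m e∣n) (*-monoˡ-< e z<n/e)
    adjacent : ∀ {z w} → Adj (n / e) D' z w → Adj n D (z * e) (w * e)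
    adjacent {z} {w} (z≢w , col∈D') = (λ same → z≢w (*-cancelʳ-≡ z w e same)) ,
                                      subst (_∈ D) (sym (colour-multiply z w)) (∈D'⇒*e∈D col∈D')

module CRT-Clique {n d e : ℕ} .{{_ : NonZero d}} (1<n : 1 < n) (e*d≡n : e * d ≡ n) (1<e : 1 < e)
                  {F : ℕ} (d*d∣F : d * d ∣ F) (F≡1-modQ : ∀ {ℓ} .{{_ : NonZero ℓ}} → QPrime n d ℓ → F % ℓ ≡ 1 % ℓ)
                  {m : ℕ} (m≤p*r : m ≤ f n * f e) (m≤Q : ∀ {ℓ} → QPrime n d ℓ → m ≤ ℓ) where

  private
    instance
      n≢0 : NonZero n
      n≢0 = >-nonZero (<-trans z<s 1<n)
      e≢0 : NonZero e
      e≢0 = >-nonZero (<-trans z<s 1<e)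
      p≢0 : NonZero (f n)
      p≢0 = prime⇒nonZero (f-prime 1<n)

    p r : ℕ
    p = f n
    r = f e

    d*e≡n : d * e ≡ n
    d*e≡n = trans (*-comm d e) e*d≡n

    -- G ≡ 1 - F (mod n), so x k ≡ k·F + A k·(1 - F) picks k where F ≡ 1 and A k where F ≡ 0.
    G : ℕ
    G = pred n * F + 1

    A : ℕ → ℕ
    A k = k % p + k / p * d

  x : ℕ → ℕ
  x k = (A k * G + k * F) % n

  private
    x≡A : ∀ {c} .{{_ : NonZero c}} → c ∣ n → c ∣ F → ∀ k → x k % c ≡ A k % c
    x≡A {c} c∣n c∣F k = begin
      x k % c                            ≡⟨ m∣n⇒o%n%m≡o%m c n _ c∣n ⟩
      (A k * G + k * F) % c              ≡⟨ cong (_% c) (expand (A k) (pred n) F k) ⟩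
      (A k + (A k * pred n + k) * F) % c ≡⟨ %-remove-+ʳ (A k) (∣n⇒∣m*n (A k * pred n + k) c∣F) ⟩
      A k % c                            ∎
      where
      open ≡-Reasoning
      expand : ∀ a q f k → a * (q * f + 1) + k * f ≡ a + (a * q + k) * f
      expand = +-*-Solver.solve 4 (λ a q f k → a :* (q :* f :+ con 1) :+ k :* f := a :+ (a :* q :+ k) :* f) refl
        where open +-*-Solver

    x≡k : ∀ {c} .{{_ : NonZero c}} → c ∣ n → F % c ≡ 1 % c → ∀ k → x k % c ≡ k % c
    x≡k {c} c∣n F≡1 k = begin
      x k % c               ≡⟨ m∣n⇒o%n%m≡o%m c n _ c∣n ⟩
      (A k * G + k * F) % c ≡⟨ %-remove-+ˡ (k * F) (∣n⇒∣m*n (A k) c∣G) ⟩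
      (k * F) % c           ≡⟨ %-cong-*ˡ c k F≡1 ⟩
      (k * 1) % c           ≡⟨ cong (_% c) (*-identityʳ k) ⟩
      k % c                 ∎
      where
      open ≡-Reasoning
      G+F≡1+n*F : G + F ≡ 1 + n * F
      G+F≡1+n*F = trans (+-*-Solver.solve 2 (λ q f → q :* f :+ con 1 :+ f := con 1 :+ (con 1 :+ q) :* f) refl (pred n) F)
                        (cong (λ t → 1 + t * F) (suc-pred n))
        where open +-*-Solver
      G+F≡F : (G + F) % c ≡ F % c
      G+F≡F = trans (cong (_% c) G+F≡1+n*F) (trans (%-remove-+ʳ 1 (∣m⇒∣m*n F c∣n)) (sym F≡1))
      c∣G : c ∣ G
      c∣G = subst (c ∣_) (trans (m≤n⇒∣n-m∣≡n∸m (m≤n+m F G)) (m+n∸n≡m G F)) (%≡%⇒∣∣m-n∣ c (G + F) F G+F≡F)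

    Q-separates : ∀ {ℓ k k'} → QPrime n d ℓ → k < m → k' < m → ℓ ∣ ∣ x k - x k' ∣ → k ≡ k'
    Q-separates {ℓ} {k} {k'} qℓ@(pℓ , ℓ∣n , _) k<m k'<m ℓ∣diff = begin
      k        ≡⟨ sym (m<n⇒m%n≡m (<-≤-trans k<m (m≤Q qℓ))) ⟩
      k % ℓ    ≡⟨ sym (x≡k ℓ∣n F≡1 k) ⟩
      x k % ℓ  ≡⟨ ∣∣m-n∣⇒%≡% ℓ (x k) (x k') ℓ∣diff ⟩
      x k' % ℓ ≡⟨ x≡k ℓ∣n F≡1 k' ⟩
      k' % ℓ   ≡⟨ m<n⇒m%n≡m (<-≤-trans k'<m (m≤Q qℓ)) ⟩
      k'       ∎
      where
      open ≡-Reasoning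
      instance
        ℓ≢0 : NonZero ℓ
        ℓ≢0 = prime⇒nonZero pℓ
      F≡1 : F % ℓ ≡ 1 % ℓ
      F≡1 = F≡1-modQ qℓ

    ∣d-separates : ∀ {ℓ k k'} → Prime ℓ → ℓ ∣ d → ℓ ∣ ∣ x k - x k' ∣ → k % p ≡ k' % p
    ∣d-separates {ℓ} {k} {k'} pℓ ℓ∣d ℓ∣diff = begin
      k % p    ≡⟨ sym (x≡k%p k) ⟩
      x k % ℓ  ≡⟨ ∣∣m-n∣⇒%≡% ℓ (x k) (x k') ℓ∣diff ⟩
      x k' % ℓ ≡⟨ x≡k%p k' ⟩
      k' % p   ∎
      where
      open ≡-Reasoning
      instance
        ℓ≢0 : NonZero ℓ
        ℓ≢0 = prime⇒nonZero pℓ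
      ℓ∣n : ℓ ∣ n
      ℓ∣n = ∣-trans ℓ∣d (divides e (sym e*d≡n))
      x≡k%p : ∀ k → x k % ℓ ≡ k % p
      x≡k%p k = begin
        x k % ℓ   ≡⟨ x≡A ℓ∣n (∣-trans ℓ∣d (∣-trans (m∣m*n d) d*d∣F)) k ⟩
        A k % ℓ   ≡⟨ %-remove-+ʳ (k % p) (∣n⇒∣m*n (k / p) ℓ∣d) ⟩
        k % p % ℓ ≡⟨ m<n⇒m%n≡m (<-≤-trans (m%n<n k p) (f-minimal 1<n pℓ ℓ∣n)) ⟩
        k % p     ∎

    d∣x-diff : ∀ {k k'} → k % p ≡ k' % p → d ∣ ∣ x k - x k' ∣
    d∣x-diff {k} {k'} same = %≡%⇒∣∣m-n∣ d (x k) (x k') (begin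
      x k % d       ≡⟨ x≡A d∣n (∣-trans (m∣m*n d) d*d∣F) k ⟩
      A k % d       ≡⟨ %-remove-+ʳ (k % p) (n∣m*n (k / p)) ⟩
      k % p % d     ≡⟨ cong (_% d) same ⟩
      k' % p % d    ≡⟨ sym (%-remove-+ʳ (k' % p) (n∣m*n (k' / p))) ⟩
      A k' % d      ≡⟨ sym (x≡A d∣n (∣-trans (m∣m*n d) d*d∣F) k') ⟩
      x k' % d      ∎)
      where
      open ≡-Reasoning
      d∣n : d ∣ n
      d∣n = divides e (sym e*d≡n)

    -- The digit k / p stays below r ≤ ℓ, so d·ℓ cannot divide the difference.
    digit-gap : ∀ {ℓ k k'} → k' < k → k < m → k % p ≡ k' % p → Prime ℓ → ℓ ∣ d → ℓ ∣ e →
                ¬ d * ℓ ∣ ∣ x k - x k' ∣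
    digit-gap {ℓ} {k} {k'} k'<k k<m same pℓ ℓ∣d ℓ∣e dℓ∣diff =
      <⇒≱ (<-≤-trans gap<r (f-minimal 1<e pℓ ℓ∣e)) (∣⇒≤ {{>-nonZero 0<gap}} ℓ∣gap)
      where
      instance
        ℓ≢0 : NonZero ℓ
        ℓ≢0 = prime⇒nonZero pℓ
        dℓ≢0 : NonZero (d * ℓ)
        dℓ≢0 = m*n≢0 d ℓ
      j j' : ℕ
      j = k / p
      j' = k' / p
      same-A : A k % (d * ℓ) ≡ A k' % (d * ℓ)
      same-A = trans (sym (x≡A dℓ∣n dℓ∣F k)) (trans (∣∣m-n∣⇒%≡% (d * ℓ) (x k) (x k') dℓ∣diff) (x≡A dℓ∣n dℓ∣F k'))
        where
        dℓ∣n : d * ℓ ∣ n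
        dℓ∣n = subst (d * ℓ ∣_) d*e≡n (*-monoʳ-∣ d ℓ∣e)
        dℓ∣F : d * ℓ ∣ F
        dℓ∣F = ∣-trans (*-monoʳ-∣ d ℓ∣d) d*d∣F
      ℓ∣gap : ℓ ∣ ∣ j - j' ∣
      ℓ∣gap = *-cancelʳ-∣ d (subst₂ _∣_ (*-comm d ℓ) A-gap (%≡%⇒∣∣m-n∣ (d * ℓ) (A k) (A k') same-A))
        where
        A-gap : ∣ A k - A k' ∣ ≡ ∣ j - j' ∣ * d
        A-gap = trans (cong (λ t → ∣ A k - t + j' * d ∣) (sym same)) (∣m+n*c-m+o*c∣≡∣n-o∣*c (k % p) j j' d)
      j'≤j : j' ≤ j
      j'≤j = /-monoˡ-≤ p (<⇒≤ k'<k)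
      gap≡ : ∣ j - j' ∣ ≡ j ∸ j'
      gap≡ = m≤n⇒∣n-m∣≡n∸m j'≤j
      0<gap : 0 < ∣ j - j' ∣
      0<gap = subst (0 <_) (sym gap≡) (m<n⇒0<n∸m (≤∧≢⇒< j'≤j λ j'≡j → <⇒≢ k'<k (%∧/-injective p (sym same) j'≡j)))
      gap<r : ∣ j - j' ∣ < r
      gap<r = ≤-<-trans (subst (_≤ j) (sym gap≡) (m∸n≤m j j'))
                        (m<n*o⇒m/o<n (subst (k <_) (*-comm p r) (<-≤-trans k<m m≤p*r)))

    module _ {k k'} (k'<k : k' < k) (k<m : k < m) where

      Q∤x-diff : ∀ {ℓ} → QPrime n d ℓ → ¬ ℓ ∣ ∣ x k - x k' ∣
      Q∤x-diff qℓ ℓ∣diff = <⇒≢ k'<k (sym (Q-separates qℓ k<m (<-trans k'<k k<m) ℓ∣diff))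

      colour≡1 : k % p ≢ k' % p → colour n (x k) (x k') ≡ 1
      colour≡1 different = gcd≡1-byPrimes ∣ x k - x k' ∣ n no-prime
        where
        no-prime : ∀ {ℓ} → Prime ℓ → ℓ ∣ n → ¬ ℓ ∣ ∣ x k - x k' ∣
        no-prime {ℓ} pℓ ℓ∣n ℓ∣diff with ℓ ∣? d
        ... | yes ℓ∣d = different (∣d-separates pℓ ℓ∣d ℓ∣diff)
        ... | no ℓ∤d = Q∤x-diff (pℓ , ℓ∣n , ℓ∤d) ℓ∣diff

      colour≡d : k % p ≡ k' % p → colour n (x k) (x k') ≡ d
      colour≡d same = subst (λ t → gcd ∣ x k - x k' ∣ t ≡ d) d*e≡n (gcd≡d-byPrimes ∣ x k - x k' ∣ d e (d∣x-diff same) no-lift)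
        where
        no-lift : ∀ {ℓ} → Prime ℓ → ℓ ∣ e → ¬ d * ℓ ∣ ∣ x k - x k' ∣
        no-lift {ℓ} pℓ ℓ∣e with ℓ ∣? d
        ... | yes ℓ∣d = digit-gap k'<k k<m same pℓ ℓ∣d ℓ∣e
        ... | no ℓ∤d = λ dℓ∣diff → Q∤x-diff (pℓ , ∣-trans ℓ∣e (divides d (sym d*e≡n)) , ℓ∤d) (m*n∣⇒n∣ d ℓ dℓ∣diff)

      x-adjacent : Adj n (d ∷ 1 ∷ []) (x k) (x k')
      x-adjacent with k % p ≟ k' % p
      ... | yes same = colour<n⇒≢ (colour≡d same) d<n , here (colour≡d same)
        where
        d<n : d < n
        d<n = subst₂ _<_ (*-identityˡ d) e*d≡n (*-monoˡ-< d 1<e)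
      ... | no different = colour<n⇒≢ (colour≡1 different) 1<n , there (here (colour≡1 different))

  clique : HasCliqueOfSize n (d ∷ 1 ∷ []) m
  clique = downFrom-clique x m (λ {k} _ → m%n<n (A k * G + k * F) n) x-adjacent


f[n/d]*d∣n : ∀ {n d} .{{_ : NonZero d}} → d ∣ n → d < n → f (n / d) * d ∣ n
f[n/d]*d∣n {n} {d} d∣n d<n = subst (f (n / d) * d ∣_) (m/n*n≡m d∣n) (*-monoˡ-∣ d (f-∣ (1<n/d d∣n d<n)))

1<f[n/d] : ∀ {n d} .{{_ : NonZero d}} → d ∣ n → d < n → 1 < f (n / d)
1<f[n/d] d∣n d<n = prime⇒1< (f-prime (1<n/d d∣n d<n))

cliqueNumber[d,1] : ∀ {n d} .{{_ : NonZero d}} → 1 < n → d ∣ n → d < n →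
                    CliqueNumber n (d ∷ 1 ∷ []) (minWith (minQ n d) (f n * f (n / d)))
cliqueNumber[d,1] {n} {d} 1<n d∣n d<n
  with F , d*d∣F , F≡1-modQ ← ∃[d*d]-multiple≡1-modQ n d {{>-nonZero (<-trans z<s 1<n)}}
     | M≤p*r , M≤Q ← minWith-minQ-lowerBound d (f n * f (n / d)) (<-trans z<s 1<n) =
  CRT-Clique.clique 1<n (m/n*n≡m d∣n) (1<n/d d∣n d<n) d*d∣F F≡1-modQ M≤p*r M≤Q ,
  λ C clique → minWith-minQ-greatest
    (clique[d,1]≤p*r (f-prime 1<n) (f-∣ 1<n) (1<f[n/d] d∣n d<n) (f[n/d]*d∣n d∣n d<n) clique)
    (λ qℓ@(pℓ , ℓ∣n , _) → ∤colours⇒length≤ {{prime⇒nonZero pℓ}} ℓ∣n (QPrime⇒∤[d,1] qℓ) clique)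

cliqueNumber-rescale : ∀ {n d₁ e} .{{_ : NonZero e}} → e ∣ n → e ∣ d₁ → ∀ k →
  (CliqueNumber n (d₁ ∷ e ∷ []) k → CliqueNumber (n / e) (1 ∷ d₁ / e ∷ []) k)
  × (CliqueNumber (n / e) (1 ∷ d₁ / e ∷ []) k → CliqueNumber n (d₁ ∷ e ∷ []) k)
cliqueNumber-rescale e∣n e∣d₁ k =
  cliqueNumber-transfer (divide-hom e∣n e∣d₁) (multiply-hom e∣n e∣d₁) ,
  cliqueNumber-transfer (multiply-hom e∣n e∣d₁) (divide-hom e∣n e∣d₁)

cliqueNumber[d₁,d₂]-∤ : ∀ {n d₁ d₂} .{{_ : NonZero d₁}} .{{_ : NonZero d₂}} → d₁ ∣ n → d₁ < n →
                        d₂ ∣ n → d₂ < d₁ → ¬ d₂ ∣ d₁ → CliqueNumber n (d₁ ∷ d₂ ∷ []) (f (n / d₁) ⊔ f (n / d₂))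
cliqueNumber[d₁,d₂]-∤ {n} {d₁} {d₂} d₁∣n d₁<n d₂∣n d₂<d₁ d₂∤d₁ = larger-progression , bounded
  where
  d₂<n : d₂ < n
  d₂<n = <-trans d₂<d₁ d₁<n
  larger-progression : HasCliqueOfSize n (d₁ ∷ d₂ ∷ []) (f (n / d₁) ⊔ f (n / d₂))
  larger-progression with ≤-total (f (n / d₁)) (f (n / d₂))
  ... | inj₁ r₁≤r₂ = subst (HasCliqueOfSize n _) (sym (m≤n⇒m⊔n≡n r₁≤r₂))
                           (progression-clique (m/n*n≡m d₂∣n) (1<n/d d₂∣n d₂<n) (there (here refl)))
  ... | inj₂ r₂≤r₁ = subst (HasCliqueOfSize n _) (sym (m≥n⇒m⊔n≡m r₂≤r₁))
                           (progression-clique (m/n*n≡m d₁∣n) (1<n/d d₁∣n d₁<n) (here refl))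
  bounded : ∀ C → IsClique n (d₁ ∷ d₂ ∷ []) C → length C ≤ f (n / d₁) ⊔ f (n / d₂)
  bounded C clique with clique-monochromatic d₂∣n d₂∤d₁ d₁∣n d₂<d₁ C clique
  ... | inj₁ only-d₁ = ≤-trans (monochromatic⇒length≤ (1<f[n/d] d₁∣n d₁<n) (f[n/d]*d∣n d₁∣n d₁<n) clique only-d₁)
                               (m≤m⊔n _ _)
  ... | inj₂ only-d₂ = ≤-trans (monochromatic⇒length≤ (1<f[n/d] d₂∣n d₂<n) (f[n/d]*d∣n d₂∣n d₂<n) clique only-d₂)
                               (m≤n⊔m _ _)

theorem3p1 : (n d₁ d₂ : ℕ) → 1 < n →
    (d₁>0 : 0 < d₁) → d₁ ∣ n → d₁ < n →
    (d₂>0 : 0 < d₂) → d₂ ∣ n → d₂ < d₁ →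
    (d₂ ≡ 1 → CliqueNumber n (d₁ ∷ d₂ ∷ []) (minWith (minQ n d₁) (f n * f (_/_ n d₁ {{>-nonZero d₁>0}}))))
    × (d₂ ∣ d₁ → 1 < d₂ → ∀ k →
        (CliqueNumber n (d₁ ∷ d₂ ∷ []) k → CliqueNumber (_/_ n d₂ {{>-nonZero d₂>0}}) (1 ∷ _/_ d₁ d₂ {{>-nonZero d₂>0}} ∷ []) k)
        × (CliqueNumber (_/_ n d₂ {{>-nonZero d₂>0}}) (1 ∷ _/_ d₁ d₂ {{>-nonZero d₂>0}} ∷ []) k → CliqueNumber n (d₁ ∷ d₂ ∷ []) k))
    × (d₂ ≢ 1 → ¬ (d₂ ∣ d₁) → CliqueNumber n (d₁ ∷ d₂ ∷ []) (f (_/_ n d₁ {{>-nonZero d₁>0}}) ⊔ f (_/_ n d₂ {{>-nonZero d₂>0}})))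
theorem3p1 n d₁ d₂ 1<n d₁>0 d₁∣n d₁<n d₂>0 d₂∣n d₂<d₁ =
    (λ { refl → cliqueNumber[d,1] 1<n d₁∣n d₁<n })
  , (λ d₂∣d₁ _ → cliqueNumber-rescale d₂∣n d₂∣d₁)
  , (λ _ d₂∤d₁ → cliqueNumber[d₁,d₂]-∤ d₁∣n d₁<n d₂∣n d₂<d₁ d₂∤d₁)
  where
  instance
    d₁≢0 : NonZero d₁
    d₁≢0 = >-nonZero d₁>0
    d₂≢0 : NonZero d₂
    d₂≢0 = >-nonZero d₂>0
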